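{- Let $g$ be a normalized arithmetic function of moderate growth and let $1\le m\le n$. Then $$\frac{A_{n,m}^{g,\mathrm{id}}}{n!}=\frac{1}{m!}\sum_{\substack{k_1,\dots,k_m\in\mathbb{N}\\k_1+\dots+k_m=n}}\prod_{i=1}^m\frac{g(k_i)}{k_i},\qquad A_{n,m}^{g,1}=\sum_{\substack{k_1,\dots,k_m\in\mathbb{N}\\k_1+\dots+k_m=n}}\prod_{i=1}^m g(k_i).$$
   Context: An arithmetic function is a map $g:\mathbb{N}=\{1,2,\dots\}\to\mathbb{C}$; normalized means $g(1)=1$; moderate growth means $\sum_{n\ge1}g(n)q^n$ has positive radius of convergence. For $h\in\{1,\mathrm{id}\}$ (the constant function $1$ and $\mathrm{id}(n)=n$) define $P_0^{g,h}(x):=1$ and $P_n^{g,h}(x):=\frac{x}{h(n)}\sum_{k=1}^n g(k)P_{n-k}^{g,h}(x)$ for $n\ge1$. $A_{n,m}^{g,1}$ is the coefficient of $x^m$ in $P_n^{g,1}(x)$, and $A_{n,m}^{g,\mathrm{id}}$ is the coefficient of $x^m$ in $n!\,P_n^{g,\mathrm{id}}(x)$. -}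

module Defs where

open import Level using (Level; _⊔_) renaming (suc to lsuc)
open import Algebra.Bundles using (CommutativeRing)
open import Data.Nat using (ℕ; zero; suc; _∸_)
open import Data.List using (List; []; _∷_; map; foldr; zipWith; upTo; concatMap)
open import Relation.Nullary using (¬_)

ι : ∀ {c ℓ} (R : CommutativeRing c ℓ) → ℕ → CommutativeRing.Carrier R
ι R zero = CommutativeRing.0# R
ι R (suc n) = CommutativeRing._+_ R (CommutativeRing.1# R) (ι R n)

record CharZeroField c ℓ : Set (lsuc (c ⊔ ℓ)) where
  field
    commRing : CommutativeRing c ℓ
  open CommutativeRing commRing public
  field
    _⁻¹ : Carrier → Carrier
    ⁻¹-inverse : ∀ x → ¬ (x ≈ 0#) → x * (x ⁻¹) ≈ 1#
    charZero : ∀ n → ¬ (ι commRing (suc n) ≈ 0#)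

module WithField {c ℓ} (F : CharZeroField c ℓ) where
  open CharZeroField F

  nat : ℕ → Carrier
  nat = ι commRing

  sumF : List Carrier → Carrier
  sumF = foldr _+_ 0#

  prodF : List Carrier → Carrier
  prodF = foldr _*_ 1#

  -- Polynomials in x over the field, as coefficient sequences (coefficient of x^m).
  Poly : Set c
  Poly = ℕ → Carrier

  zeroP : Poly
  zeroP _ = 0#

  oneP : Poly
  oneP zero = 1#
  oneP (suc _) = 0#

  addP : Poly → Poly → Poly
  addP p q m = p m + q m

  scaleP : Carrier → Poly → Poly
  scaleP a p m = a * p m

  xmulP : Poly → Poly
  xmulP p zero = 0#
  xmulP p (suc m) = p m

  sumP : List Poly → Poly
  sumP = foldr addP zeroP

  -- PsRev h g n = [P_n, P_{n-1}, ..., P_0] for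
  -- P_0 = 1,  P_n = (x / h(n)) * Σ_{k=1}^n g(k) P_{n-k}.
  PsRev : (ℕ → Carrier) → (ℕ → Carrier) → ℕ → List Poly
  PsRev h g zero = oneP ∷ []
  PsRev h g (suc n) =
    scaleP (h (suc n) ⁻¹)
      (xmulP (sumP (zipWith (λ k p → scaleP (g k) p) (map suc (upTo (suc n))) (PsRev h g n))))
    ∷ PsRev h g n

  P : (ℕ → Carrier) → (ℕ → Carrier) → ℕ → Poly
  P h g n with PsRev h g n
  ... | p ∷ _ = p
  ... | [] = zeroP

  hOne : ℕ → Carrier
  hOne _ = 1#

  hId : ℕ → Carrier
  hId = nat

  factorial : ℕ → ℕ
  factorial zero = 1
  factorial (suc n) = suc n Data.Nat.* factorial n

  A-one : (ℕ → Carrier) → ℕ → ℕ → Carrier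
  A-one g n m = P hOne g n m

  A-id : (ℕ → Carrier) → ℕ → ℕ → Carrier
  A-id g n m = nat (factorial n) * P hId g n m

compositions : ℕ → ℕ → List (List ℕ)
compositions zero zero = [] ∷ []
compositions zero (suc n) = []
compositions (suc m) n =
  concatMap (λ k → map (k ∷_) (compositions m (n ∸ k))) (map suc (upTo n))

{-# OPTIONS --safe #-}
-- Read a sequence as the coefficients of a power series in q and ⋆ as their product.
-- The recursion says that h(n) times the coefficient of x^(m+1) in P_n is the n-th
-- coefficient of G ⋆ C_m, where G = Σ_{k ≥ 1} g(k) qᵏ and C_m collects the
-- coefficients of xᵐ in P_0, P_1, …; the n-th coefficient of G ^ m is the
-- composition sum of g over (m, n).
-- For h = 1 this gives C_m = G ^ m at once. For h = id, multiplication by n is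
-- the derivation D = q d/dq, and G = D W for W = Σ_{k ≥ 1} (g(k)/k) qᵏ, so the
-- power rule D (W ^ (m+1)) = (m+1) · D W ⋆ W ^ m gives m! · C_m = W ^ m by induction.
module Submission where

open import Defs
open import Data.Nat using (ℕ; _≤_; zero; suc; _∸_; NonZero)
import Data.Nat as ℕ
open import Data.Nat.Properties using (m*n≢0)
open import Data.List using (List; []; _∷_; _++_; foldr; map; upTo; applyUpTo; concatMap; zipWith)
open import Data.List.Properties using (map-applyUpTo)
open import Data.Product using (_×_; _,_)
open import Function using (_∘_)
open import Relation.Nullary using (¬_)
open import Algebra.Bundles using (CommutativeRing)
import Relation.Binary.PropositionalEquality as ≡

module CauchyProduct {c ℓ} (R : CommutativeRing c ℓ) where
  open CommutativeRing R hiding (zero)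
  open import Relation.Binary.Reasoning.Setoid setoid
  open import Algebra.Solver.Ring.NaturalCoefficients.Default commutativeSemiring
    using (solve; _:=_; _:+_; _:*_)
  open import Algebra.Properties.Semiring.Mult semiring using (×1-homo-*) renaming (_×_ to _·_)

  nat : ℕ → Carrier
  nat = ι R

  nat≈·1# : ∀ n → nat n ≈ n · 1#
  nat≈·1# zero = refl
  nat≈·1# (suc n) = +-congˡ (nat≈·1# n)

  nat-* : ∀ m n → nat (m ℕ.* n) ≈ nat m * nat n
  nat-* m n = begin
    nat (m ℕ.* n)            ≈⟨ nat≈·1# (m ℕ.* n) ⟩
    (m ℕ.* n) · 1#           ≈⟨ ×1-homo-* m n ⟩
    (m · 1#) * (n · 1#)      ≈⟨ *-cong (nat≈·1# m) (nat≈·1# n) ⟨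
    nat m * nat n            ∎

  nat-suc : ∀ n x → nat (suc n) * x ≈ x + nat n * x
  nat-suc n x = trans (distribʳ x 1# (nat n)) (+-congʳ (*-identityˡ x))

  Seq : Set c
  Seq = ℕ → Carrier

  infix 4 _≐_
  _≐_ : Seq → Seq → Set ℓ
  a ≐ b = ∀ n → a n ≈ b n

  infixl 7 _⋆_
  _⋆_ : Seq → Seq → Seq
  (a ⋆ b) zero = a 0 * b 0
  (a ⋆ b) (suc n) = a 0 * b (suc n) + (a ∘ suc ⋆ b) n

  ⋆-cong : ∀ {a a′ b b′} → a ≐ a′ → b ≐ b′ → a ⋆ b ≐ a′ ⋆ b′
  ⋆-cong a≐a′ b≐b′ zero = *-cong (a≐a′ 0) (b≐b′ 0)
  ⋆-cong a≐a′ b≐b′ (suc n) =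
    +-cong (*-cong (a≐a′ 0) (b≐b′ (suc n))) (⋆-cong (a≐a′ ∘ suc) b≐b′ n)

  ⋆-congʳ : ∀ a {b b′} → b ≐ b′ → a ⋆ b ≐ a ⋆ b′
  ⋆-congʳ a = ⋆-cong {a} (λ _ → refl)

  ⋆-distribʳ-+ : ∀ a a′ b → (λ i → a i + a′ i) ⋆ b ≐ λ n → (a ⋆ b) n + (a′ ⋆ b) n
  ⋆-distribʳ-+ a a′ b zero = distribʳ (b 0) (a 0) (a′ 0)
  ⋆-distribʳ-+ a a′ b (suc n) = trans (+-congˡ (⋆-distribʳ-+ (a ∘ suc) (a′ ∘ suc) b n))
    (shuffle (a 0) (a′ 0) (b (suc n)) ((a ∘ suc ⋆ b) n) ((a′ ∘ suc ⋆ b) n))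
    where
    shuffle : ∀ x y z p q → (x + y) * z + (p + q) ≈ (x * z + p) + (y * z + q)
    shuffle = solve 5 (λ x y z p q → (x :+ y) :* z :+ (p :+ q) := (x :* z :+ p) :+ (y :* z :+ q)) refl

  ⋆-*ˡ : ∀ s a b → (λ i → s * a i) ⋆ b ≐ λ n → s * (a ⋆ b) n
  ⋆-*ˡ s a b zero = *-assoc s (a 0) (b 0)
  ⋆-*ˡ s a b (suc n) = trans (+-congˡ (⋆-*ˡ s (a ∘ suc) b n))
    (factor s (a 0) (b (suc n)) ((a ∘ suc ⋆ b) n))
    where
    factor : ∀ s x z p → s * x * z + s * p ≈ s * (x * z + p)
    factor = solve 4 (λ s x z p → s :* x :* z :+ s :* p := s :* (x :* z :+ p)) refl

  ⋆-*ʳ : ∀ s a b → a ⋆ (λ i → s * b i) ≐ λ n → s * (a ⋆ b) n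
  ⋆-*ʳ s a b zero = x*[s*z]≈s*[x*z] s (a 0) (b 0)
    where
    x*[s*z]≈s*[x*z] : ∀ s x z → x * (s * z) ≈ s * (x * z)
    x*[s*z]≈s*[x*z] = solve 3 (λ s x z → x :* (s :* z) := s :* (x :* z)) refl
  ⋆-*ʳ s a b (suc n) = trans (+-congˡ (⋆-*ʳ s (a ∘ suc) b n))
    (factor s (a 0) (b (suc n)) ((a ∘ suc ⋆ b) n))
    where
    factor : ∀ s x z p → x * (s * z) + s * p ≈ s * (x * z + p)
    factor = solve 4 (λ s x z p → x :* (s :* z) :+ s :* p := s :* (x :* z :+ p)) refl

  ⋆-zeroʳ : ∀ a {b} → b ≐ (λ _ → 0#) → a ⋆ b ≐ λ _ → 0#
  ⋆-zeroʳ a b≐0 zero = trans (*-congˡ (b≐0 0)) (zeroʳ (a 0))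
  ⋆-zeroʳ a b≐0 (suc n) =
    trans (+-cong (trans (*-congˡ (b≐0 (suc n))) (zeroʳ (a 0))) (⋆-zeroʳ (a ∘ suc) b≐0 n))
          (+-identityʳ 0#)

  ⋆-unfoldʳ : ∀ a b n → (a ⋆ b) (suc n) ≈ (a ⋆ b ∘ suc) n + a (suc n) * b 0
  ⋆-unfoldʳ a b zero = refl
  ⋆-unfoldʳ a b (suc n) = trans (+-congˡ (⋆-unfoldʳ (a ∘ suc) b n)) (sym (+-assoc _ _ _))

  ⋆-comm : ∀ a b → a ⋆ b ≐ b ⋆ a
  ⋆-comm a b zero = *-comm (a 0) (b 0)
  ⋆-comm a b (suc n) = begin
    a 0 * b (suc n) + (a ∘ suc ⋆ b) n    ≈⟨ +-congˡ (⋆-comm (a ∘ suc) b n) ⟩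
    a 0 * b (suc n) + (b ⋆ a ∘ suc) n    ≈⟨ rotate (a 0) (b (suc n)) _ ⟩
    (b ⋆ a ∘ suc) n + b (suc n) * a 0    ≈⟨ ⋆-unfoldʳ b a n ⟨
    (b ⋆ a) (suc n)                      ∎
    where
    rotate : ∀ x y p → x * y + p ≈ p + y * x
    rotate = solve 3 (λ x y p → x :* y :+ p := p :+ y :* x) refl

  ⋆-assoc : ∀ a b d → (a ⋆ b) ⋆ d ≐ a ⋆ (b ⋆ d)
  ⋆-assoc a b d zero = *-assoc (a 0) (b 0) (d 0)
  ⋆-assoc a b d (suc n) = begin
    a 0 * b 0 * d (suc n) + ((λ k → a 0 * b (suc k) + (a ∘ suc ⋆ b) k) ⋆ d) n
      ≈⟨ +-congˡ (⋆-distribʳ-+ _ _ d n) ⟩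
    a 0 * b 0 * d (suc n) + (((λ k → a 0 * b (suc k)) ⋆ d) n + ((a ∘ suc ⋆ b) ⋆ d) n)
      ≈⟨ +-congˡ (+-cong (⋆-*ˡ (a 0) (b ∘ suc) d n) (⋆-assoc (a ∘ suc) b d n)) ⟩
    a 0 * b 0 * d (suc n) + (a 0 * (b ∘ suc ⋆ d) n + (a ∘ suc ⋆ (b ⋆ d)) n)
      ≈⟨ regroup (a 0) (b 0) (d (suc n)) _ _ ⟩
    a 0 * (b 0 * d (suc n) + (b ∘ suc ⋆ d) n) + (a ∘ suc ⋆ (b ⋆ d)) n
      ∎
    where
    regroup : ∀ x y z u v → x * y * z + (x * u + v) ≈ x * (y * z + u) + v
    regroup = solve 5 (λ x y z u v → x :* y :* z :+ (x :* u :+ v) := x :* (y :* z :+ u) :+ v) refl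

  ⋆-leftComm : ∀ a b d → a ⋆ (b ⋆ d) ≐ b ⋆ (a ⋆ d)
  ⋆-leftComm a b d n = begin
    (a ⋆ (b ⋆ d)) n    ≈⟨ ⋆-assoc a b d n ⟨
    ((a ⋆ b) ⋆ d) n    ≈⟨ ⋆-cong (⋆-comm a b) (λ _ → refl) n ⟩
    ((b ⋆ a) ⋆ d) n    ≈⟨ ⋆-assoc b a d n ⟩
    (b ⋆ (a ⋆ d)) n    ∎

  δ : Seq
  δ zero = 1#
  δ (suc _) = 0#

  infixr 8 _⋆^_
  _⋆^_ : Seq → ℕ → Seq
  w ⋆^ zero = δ
  w ⋆^ suc m = w ⋆ w ⋆^ m

  D : Seq → Seq
  D a n = nat n * a n

  D-zero : ∀ a → D a 0 ≈ 0#
  D-zero a = zeroˡ (a 0)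

  D-suc : ∀ a → D a ∘ suc ≐ λ n → a (suc n) + D (a ∘ suc) n
  D-suc a n = nat-suc n (a (suc n))

  D-⋆ : ∀ a b → D (a ⋆ b) ≐ λ n → (D a ⋆ b) n + (a ⋆ D b) n
  D-⋆ a b zero = begin
    0# * (a 0 * b 0)                       ≈⟨ zeroˡ _ ⟩
    0#                                     ≈⟨ +-identityʳ 0# ⟨
    0# + 0#                                ≈⟨ +-cong (trans (*-congʳ (D-zero a)) (zeroˡ (b 0)))
                                                     (trans (*-congˡ (D-zero b)) (zeroʳ (a 0))) ⟨
    D a 0 * b 0 + a 0 * D b 0              ∎
  D-⋆ a b (suc n) = begin
    nat (suc n) * (x * y + A)
      ≈⟨ nat-suc n _ ⟩
    (x * y + A) + nat n * (x * y + A)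
      ≈⟨ expand x y (nat n) A ⟩
    (A + nat n * A) + x * (y + nat n * y)
      ≈⟨ +-cong (+-congˡ (D-⋆ (a ∘ suc) b n)) (*-congˡ (sym (nat-suc n y))) ⟩
    (A + ((D (a ∘ suc) ⋆ b) n + C)) + x * D b (suc n)
      ≈⟨ regroup A _ C _ ⟩
    (A + (D (a ∘ suc) ⋆ b) n) + (a ⋆ D b) (suc n)
      ≈⟨ +-congʳ (⋆-distribʳ-+ (a ∘ suc) (D (a ∘ suc)) b n) ⟨
    ((λ k → a (suc k) + D (a ∘ suc) k) ⋆ b) n + (a ⋆ D b) (suc n)
      ≈⟨ +-congʳ (⋆-cong (D-suc a) (λ _ → refl) n) ⟨
    (D a ∘ suc ⋆ b) n + (a ⋆ D b) (suc n)
      ≈⟨ +-congʳ (trans (+-congʳ (trans (*-congʳ (D-zero a)) (zeroˡ _))) (+-identityˡ _)) ⟨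
    (D a ⋆ b) (suc n) + (a ⋆ D b) (suc n)
      ∎
    where
    x = a 0
    y = b (suc n)
    A = (a ∘ suc ⋆ b) n
    C = (a ∘ suc ⋆ D b) n
    expand : ∀ x y N A → (x * y + A) + N * (x * y + A) ≈ (A + N * A) + x * (y + N * y)
    expand = solve 4 (λ x y N A → (x :* y :+ A) :+ N :* (x :* y :+ A) := (A :+ N :* A) :+ x :* (y :+ N :* y)) refl
    regroup : ∀ A B C X → (A + (B + C)) + X ≈ (A + B) + (X + C)
    regroup = solve 4 (λ A B C X → (A :+ (B :+ C)) :+ X := (A :+ B) :+ (X :+ C)) refl

  D-⋆^suc : ∀ w m → D (w ⋆^ suc m) ≐ λ n → nat (suc m) * (D w ⋆ w ⋆^ m) n
  D-⋆^suc w zero n = begin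
    D (w ⋆ δ) n                      ≈⟨ D-⋆ w δ n ⟩
    (D w ⋆ δ) n + (w ⋆ D δ) n        ≈⟨ +-congˡ (⋆-zeroʳ w Dδ≐0 n) ⟩
    (D w ⋆ δ) n + 0#                 ≈⟨ +-identityʳ _ ⟩
    (D w ⋆ δ) n                      ≈⟨ *-identityˡ _ ⟨
    1# * (D w ⋆ δ) n                 ≈⟨ *-congʳ (+-identityʳ 1#) ⟨
    nat 1 * (D w ⋆ δ) n              ∎
    where
    Dδ≐0 : D δ ≐ λ _ → 0#
    Dδ≐0 zero = zeroˡ 1#
    Dδ≐0 (suc i) = zeroʳ _
  D-⋆^suc w (suc m) n = begin
    D (w ⋆ v) n                                  ≈⟨ D-⋆ w v n ⟩
    (D w ⋆ v) n + (w ⋆ D v) n                    ≈⟨ +-congˡ (⋆-congʳ w (D-⋆^suc w m) n) ⟩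
    (D w ⋆ v) n + (w ⋆ (λ i → nat (suc m) * (D w ⋆ w ⋆^ m) i)) n
                                                 ≈⟨ +-congˡ (⋆-*ʳ (nat (suc m)) w _ n) ⟩
    (D w ⋆ v) n + nat (suc m) * (w ⋆ (D w ⋆ w ⋆^ m)) n
                                                 ≈⟨ +-congˡ (*-congˡ (⋆-leftComm w (D w) (w ⋆^ m) n)) ⟩
    (D w ⋆ v) n + nat (suc m) * (D w ⋆ v) n      ≈⟨ nat-suc (suc m) _ ⟨
    nat (suc (suc m)) * (D w ⋆ v) n              ∎
    where
    v = w ⋆^ suc m

  sum : List Carrier → Carrier
  sum = foldr _+_ 0#

  prod : List Carrier → Carrier
  prod = foldr _*_ 1#

  sum-map-cong : ∀ {A : Set} {f f′ : A → Carrier} → (∀ x → f x ≈ f′ x) →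
                 ∀ xs → sum (map f xs) ≈ sum (map f′ xs)
  sum-map-cong f≈f′ [] = refl
  sum-map-cong f≈f′ (x ∷ xs) = +-cong (f≈f′ x) (sum-map-cong f≈f′ xs)

  sum-map-++ : ∀ {A : Set} (f : A → Carrier) xs ys →
               sum (map f (xs ++ ys)) ≈ sum (map f xs) + sum (map f ys)
  sum-map-++ f [] ys = sym (+-identityˡ _)
  sum-map-++ f (x ∷ xs) ys = trans (+-congˡ (sum-map-++ f xs ys)) (sym (+-assoc _ _ _))

  sum-map-concatMap : ∀ {A B : Set} (f : B → Carrier) (h : A → List B) xs →
                      sum (map f (concatMap h xs)) ≈ sum (map (λ x → sum (map f (h x))) xs)
  sum-map-concatMap f h [] = refl
  sum-map-concatMap f h (x ∷ xs) =
    trans (sum-map-++ f (h x) (concatMap h xs)) (+-congˡ (sum-map-concatMap f h xs))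

  sum-prod-map-∷ : ∀ (w : Seq) k kss →
                   sum (map (prod ∘ map w) (map (k ∷_) kss)) ≈ w k * sum (map (prod ∘ map w) kss)
  sum-prod-map-∷ w k [] = sym (zeroʳ (w k))
  sum-prod-map-∷ w k (ks ∷ kss) = trans (+-congˡ (sum-prod-map-∷ w k kss)) (sym (distribˡ (w k) _ _))

  ⋆-as-sum : ∀ a b n → (a ⋆ b) n ≈ sum (applyUpTo (λ i → a i * b (n ∸ i)) (suc n))
  ⋆-as-sum a b zero = sym (+-identityʳ _)
  ⋆-as-sum a b (suc n) = +-congˡ (⋆-as-sum (a ∘ suc) b n)

  dropConstant : Seq → Seq
  dropConstant w zero = 0#
  dropConstant w (suc k) = w (suc k)

  -- Compositions only use the values w 1, w 2, …, hence the power of Σ_{k ≥ 1} w k qᵏ.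
  sum-compositions : ∀ (w : Seq) m n →
                     sum (map (prod ∘ map w) (compositions m n)) ≈ (dropConstant w ⋆^ m) n
  sum-compositions w zero zero = +-identityʳ 1#
  sum-compositions w zero (suc n) = refl
  sum-compositions w (suc m) n = begin
    sum (map (prod ∘ map w) (concatMap (λ k → map (k ∷_) (compositions m (n ∸ k))) (map suc (upTo n))))
      ≈⟨ sum-map-concatMap (prod ∘ map w) (λ k → map (k ∷_) (compositions m (n ∸ k))) (map suc (upTo n)) ⟩
    sum (map (λ k → sum (map (prod ∘ map w) (map (k ∷_) (compositions m (n ∸ k))))) (map suc (upTo n)))
      ≈⟨ sum-map-cong {f′ = λ k → w k * v (n ∸ k)} (λ k → trans (sum-prod-map-∷ w k (compositions m (n ∸ k)))
                                       (*-congˡ (sum-compositions w m (n ∸ k)))) (map suc (upTo n)) ⟩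
    sum (map (λ k → w k * v (n ∸ k)) (map suc (upTo n)))
      ≡⟨ ≡.cong sum (≡.trans (≡.cong (map (λ k → w k * v (n ∸ k))) (map-applyUpTo (λ i → i) suc n))
                             (map-applyUpTo suc (λ k → w k * v (n ∸ k)) n)) ⟩
    sum (applyUpTo (λ i → w (suc i) * v (n ∸ suc i)) n)
      ≈⟨ +-identityˡ _ ⟨
    0# + sum (applyUpTo (λ i → w (suc i) * v (n ∸ suc i)) n)
      ≈⟨ +-congʳ (zeroˡ (v n)) ⟨
    sum (applyUpTo (λ i → dropConstant w i * v (n ∸ i)) (suc n))
      ≈⟨ ⋆-as-sum (dropConstant w) v n ⟨
    (dropConstant w ⋆ v) n
      ∎
    where
    v = dropConstant w ⋆^ m

module CharZeroFieldProperties {c ℓ} (F : CharZeroField c ℓ) where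
  open CharZeroField F hiding (zero)
  open WithField F using (nat; factorial)

  ⁻¹-inverseˡ : ∀ x → ¬ (x ≈ 0#) → x ⁻¹ * x ≈ 1#
  ⁻¹-inverseˡ x x≉0 = trans (*-comm (x ⁻¹) x) (⁻¹-inverse x x≉0)

  ⁻¹-cancelˡ : ∀ {x} y → ¬ (x ≈ 0#) → x ⁻¹ * (x * y) ≈ y
  ⁻¹-cancelˡ {x} y x≉0 =
    trans (sym (*-assoc (x ⁻¹) x y)) (trans (*-congʳ (⁻¹-inverseˡ x x≉0)) (*-identityˡ y))

  1#≉0# : ¬ (1# ≈ 0#)
  1#≉0# 1≈0 = charZero 0 (trans (+-identityʳ 1#) 1≈0)

  nat≉0# : ∀ n → {{NonZero n}} → ¬ (nat n ≈ 0#)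
  nat≉0# (suc n) = charZero n

  factorial-nonZero : ∀ n → NonZero (factorial n)
  factorial-nonZero zero = _
  factorial-nonZero (suc n) = m*n≢0 (suc n) (factorial n) {{_}} {{factorial-nonZero n}}

  factorial≉0# : ∀ n → ¬ (nat (factorial n) ≈ 0#)
  factorial≉0# n = nat≉0# (factorial n) {{factorial-nonZero n}}

module CoefficientsOfP {c ℓ} (F : CharZeroField c ℓ) where
  open CharZeroField F hiding (zero)
  open WithField F
  open CauchyProduct commRing hiding (nat)
  open CharZeroFieldProperties F
  open import Relation.Binary.Reasoning.Setoid setoid
  open import Algebra.Solver.Ring.NaturalCoefficients.Default commutativeSemiring
    using (solve; _:=_; _:*_)

  column : Seq → Seq → ℕ → Seq
  column h g m j = P h g j m

  module _ (h g : Seq) where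

    sumP-zipWith-PsRev : ∀ m f n →
      sumP (zipWith (λ k p → scaleP (g k) p) (applyUpTo f (suc n)) (PsRev h g n)) m ≈ (g ∘ f ⋆ column h g m) n
    sumP-zipWith-PsRev m f zero = +-identityʳ _
    sumP-zipWith-PsRev m f (suc n) = +-congˡ (sumP-zipWith-PsRev m (f ∘ suc) n)

    P-suc-suc : ∀ n m → P h g (suc n) (suc m) ≈ h (suc n) ⁻¹ * (dropConstant g ⋆ column h g m) (suc n)
    P-suc-suc n m = *-congˡ (begin
      sumP (zipWith (λ k p → scaleP (g k) p) (map suc (upTo (suc n))) (PsRev h g n)) m
        ≡⟨ ≡.cong (λ ks → sumP (zipWith (λ k p → scaleP (g k) p) ks (PsRev h g n)) m)
                  (map-applyUpTo (λ i → i) suc (suc n)) ⟩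
      sumP (zipWith (λ k p → scaleP (g k) p) (applyUpTo suc (suc n)) (PsRev h g n)) m
        ≈⟨ sumP-zipWith-PsRev m suc n ⟩
      (g ∘ suc ⋆ column h g m) n
        ≈⟨ +-identityˡ _ ⟨
      0# + (g ∘ suc ⋆ column h g m) n
        ≈⟨ +-congʳ (zeroˡ _) ⟨
      (dropConstant g ⋆ column h g m) (suc n)
        ∎)

  column-hOne : ∀ g m → column hOne g m ≐ dropConstant g ⋆^ m
  column-hOne g zero zero = refl
  column-hOne g zero (suc n) = zeroʳ _
  column-hOne g (suc m) zero = sym (zeroˡ _)
  column-hOne g (suc m) (suc n) = begin
    P hOne g (suc n) (suc m)                               ≈⟨ P-suc-suc hOne g n m ⟩
    1# ⁻¹ * (G ⋆ column hOne g m) (suc n)                  ≈⟨ *-congˡ (⋆-congʳ G (column-hOne g m) (suc n)) ⟩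
    1# ⁻¹ * (G ⋆ G ⋆^ m) (suc n)                           ≈⟨ *-congˡ (*-identityˡ _) ⟨
    1# ⁻¹ * (1# * (G ⋆ G ⋆^ m) (suc n))                    ≈⟨ ⁻¹-cancelˡ _ 1#≉0# ⟩
    (G ⋆ G ⋆^ m) (suc n)                                   ∎
    where
    G = dropConstant g

  D-dropConstant-÷ : ∀ g → D (dropConstant (λ k → g k * (nat k ⁻¹))) ≐ dropConstant g
  D-dropConstant-÷ g zero = zeroˡ 0#
  D-dropConstant-÷ g (suc k) = begin
    nat (suc k) * (g (suc k) * nat (suc k) ⁻¹)   ≈⟨ *-congˡ (*-comm _ _) ⟩
    nat (suc k) * (nat (suc k) ⁻¹ * g (suc k))   ≈⟨ *-assoc _ _ _ ⟨
    nat (suc k) * nat (suc k) ⁻¹ * g (suc k)     ≈⟨ *-congʳ (⁻¹-inverse _ (charZero k)) ⟩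
    1# * g (suc k)                               ≈⟨ *-identityˡ _ ⟩
    g (suc k)                                    ∎

  factorial-*-column-hId : ∀ g m →
    (λ n → nat (factorial m) * column hId g m n) ≐ dropConstant (λ k → g k * (nat k ⁻¹)) ⋆^ m
  factorial-*-column-hId g zero zero = trans (*-congʳ (+-identityʳ 1#)) (*-identityˡ 1#)
  factorial-*-column-hId g zero (suc n) = trans (*-congˡ (zeroʳ _)) (zeroʳ _)
  factorial-*-column-hId g (suc m) zero = trans (zeroʳ _) (sym (zeroˡ _))
  factorial-*-column-hId g (suc m) (suc n) = begin
    nat (factorial (suc m)) * P hId g N (suc m)
      ≈⟨ *-cong (nat-* (suc m) (factorial m)) (P-suc-suc hId g n m) ⟩
    (nat (suc m) * nat (factorial m)) * (nat N ⁻¹ * (G ⋆ column hId g m) N)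
      ≈⟨ regroup _ _ _ _ ⟩
    nat N ⁻¹ * (nat (suc m) * (nat (factorial m) * (G ⋆ column hId g m) N))
      ≈⟨ *-congˡ (*-congˡ (⋆-*ʳ _ G (column hId g m) N)) ⟨
    nat N ⁻¹ * (nat (suc m) * (G ⋆ (λ j → nat (factorial m) * column hId g m j)) N)
      ≈⟨ *-congˡ (*-congˡ (⋆-cong (λ k → sym (D-dropConstant-÷ g k)) (factorial-*-column-hId g m) N)) ⟩
    nat N ⁻¹ * (nat (suc m) * (D W ⋆ W ⋆^ m) N)
      ≈⟨ *-congˡ (D-⋆^suc W m N) ⟨
    nat N ⁻¹ * (nat N * (W ⋆^ suc m) N)
      ≈⟨ ⁻¹-cancelˡ _ (charZero n) ⟩
    (W ⋆^ suc m) N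
      ∎
    where
    N = suc n
    G = dropConstant g
    W = dropConstant (λ k → g k * (nat k ⁻¹))
    regroup : ∀ a b c d → (a * b) * (c * d) ≈ c * (a * (b * d))
    regroup = solve 4 (λ a b c d → (a :* b) :* (c :* d) := c :* (a :* (b :* d))) refl

  A-id-formula : ∀ g m n →
    A-id g n m * nat (factorial n) ⁻¹
      ≈ nat (factorial m) ⁻¹ * sumF (map (λ ks → prodF (map (λ k → g k * (nat k ⁻¹)) ks)) (compositions m n))
  A-id-formula g m n = begin
    nat (factorial n) * P hId g n m * nat (factorial n) ⁻¹
      ≈⟨ trans (*-comm _ _) (⁻¹-cancelˡ _ (factorial≉0# n)) ⟩
    P hId g n m
      ≈⟨ ⁻¹-cancelˡ _ (factorial≉0# m) ⟨
    nat (factorial m) ⁻¹ * (nat (factorial m) * P hId g n m)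
      ≈⟨ *-congˡ (factorial-*-column-hId g m n) ⟩
    nat (factorial m) ⁻¹ * (dropConstant w ⋆^ m) n
      ≈⟨ *-congˡ (sum-compositions w m n) ⟨
    nat (factorial m) ⁻¹ * sum (map (prod ∘ map w) (compositions m n))
      ∎
    where
    w : Seq
    w k = g k * (nat k ⁻¹)

  A-one-formula : ∀ g m n → A-one g n m ≈ sumF (map (λ ks → prodF (map g ks)) (compositions m n))
  A-one-formula g m n = trans (column-hOne g m n) (sym (sum-compositions g m n))

mainTheorem13 : ∀ {c ℓ} (F : CharZeroField c ℓ) →
    let open CharZeroField F
        open WithField F
    in (g : ℕ → Carrier) → g 1 ≈ 1# →
       (m n : ℕ) → 1 ≤ m → m ≤ n →
         (A-id g n m * (nat (factorial n) ⁻¹)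
            ≈ (nat (factorial m) ⁻¹) * sumF (map (λ ks → prodF (map (λ k → g k * (nat k ⁻¹)) ks)) (compositions m n)))
       × (A-one g n m
            ≈ sumF (map (λ ks → prodF (map g ks)) (compositions m n)))
mainTheorem13 F g _ m n _ _ = A-id-formula g m n , A-one-formula g m n
  where open CoefficientsOfP F
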